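{- Let $C_1$ and $C_2$ be two disjoint configurations which are strongly embroiderable according to piercing schemes $\mathcal S_1$ and $\mathcal S_2$ respectively. Let $(s,\sigma)$ be the starting point of $\mathcal S_2$. If $\sigma\in\mathcal S_1(s)$, then the configuration $C_1\cup C_2$ is strongly embroiderable according to the piercing scheme $v\mapsto \mathcal S_1(v)\cup\mathcal S_2(v)$ whose starting point is the starting point of $\mathcal S_1$.
   Context: Vertices are the points of $\mathbb Z^2$; a cell is a square $[a,a+1]\times[b,b+1]$ with $(a,b)\in\mathbb Z^2$ (its corners are its vertices); a configuration is a finite set of cells. Two vertices are adjacent if at distance $1$. The lower diagonal of a cell joins its top-right corner to its bottom-left corner; the upper diagonal joins its top-left corner to its bottom-right corner. Let $\uparrow$ denote a piercing from the back to the front of the fabric and $\downarrow$ a piercing from the front to the back. A piercing scheme $\mathcal S$ consists of a function assigning to each vertex $v\in\mathbb Z^2$ a subset $\mathcal S(v)\subseteq\{\uparrow,\downarrow\}$, together with a starting point $(s,\sigma)$ where $s$ is a vertex and $\sigma\in\mathcal S(s)$. A configuration $C$ with $n$ cells is strongly embroiderable according to $\mathcal S$ if there is a sequence of piercings $(y_1,\varepsilon_1),\dots,(y_{4n},\varepsilon_{4n})$ with $y_i\in\mathbb Z^2$, $\varepsilon_i\in\{\uparrow,\downarrow\}$, such that: $(y_1,\varepsilon_1)=(s,\sigma)$; the directions alternate cyclically ($\varepsilon_{i+1}\ne\varepsilon_i$, indices modulo $4n$); whenever $\varepsilon_i=\uparrow$ the segment $[y_i,y_{i+1}]$ (front stitch)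 is a diagonal of a cell of $C$, and the $2n$ front stitches are exactly the $2n$ diagonals of the cells of $C$, each once; whenever $\varepsilon_i=\downarrow$ the points $y_i$ and $y_{i+1}$ (indices modulo $4n$, so including the pair $y_{4n},y_1$) are adjacent (back stitch of length $1$); for each cell of $C$, its lower diagonal appears before its upper diagonal among the front stitches read in the order $i=1,\dots,4n$; and for every vertex $v$, $\mathcal S(v)=\{\varepsilon_i : y_i=v\}$. (Thus the configuration is embroidered with thread of length $2n(1+\sqrt2)$ returning to the starting point.) -}

module Defs where

open import Data.Nat as ℕ using (ℕ; zero; suc)
open import Data.Integer as ℤ using (ℤ; ∣_∣; _-_; 1ℤ)
open import Data.Integer using () renaming (_+_ to _+ℤ_)
open import Data.Fin using (Fin; zero; suc; toℕ; fromℕ<; _<_)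
open import Data.Product using (_×_; _,_; Σ; ∃; ∃-syntax)
open import Data.Sum using (_⊎_)
open import Data.Bool using (Bool; true; false; _∨_)
open import Data.List using (List; length)
open import Data.List.Membership.Propositional using (_∈_)
open import Relation.Nullary using (¬_; yes; no)
open import Relation.Binary.PropositionalEquality using (_≡_; _≢_)
open import Function.Bundles using (_⇔_)

Vertex : Set
Vertex = ℤ × ℤ

-- A cell [a,a+1]×[b,b+1] is identified by its bottom-left corner (a,b).
Cell : Set
Cell = ℤ × ℤ

-- A configuration is a finite set of cells: a duplicate-free list
-- (duplicate-freeness is imposed as a hypothesis where needed).
Configuration : Set
Configuration = List Cell

-- Piercing directions: up = back → front (↑), down = front → back (↓).
data Dir : Set where
  up down : Dir

Adjacent : Vertex → Vertex → Set
Adjacent (x₁ , y₁) (x₂ , y₂) = ∣ x₁ - x₂ ∣ ℕ.+ ∣ y₁ - y₂ ∣ ≡ 1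

data DiagKind : Set where
  lower upper : DiagKind

diagEnds : Cell → DiagKind → Vertex × Vertex
diagEnds (a , b) lower = ((a , b) , (a +ℤ 1ℤ , b +ℤ 1ℤ))
diagEnds (a , b) upper = ((a , b +ℤ 1ℤ) , (a +ℤ 1ℤ , b))

SameSegment : Vertex → Vertex → Vertex × Vertex → Set
SameSegment p q (u , v) = (p ≡ u × q ≡ v) ⊎ (p ≡ v × q ≡ u)

-- Cyclic successor on Fin m (index 4n+1 is index 1).
csuc : ∀ {m} → Fin m → Fin m
csuc {suc m} i with suc (toℕ i) ℕ.<? suc m
... | yes p = fromℕ< p
... | no _  = zero

-- Piercing scheme: S(v) ⊆ {↑,↓} as a Boolean membership function,
-- together with a starting point (s,σ) with σ ∈ S(s).
record Scheme : Set where
  field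
    S     : Vertex → Dir → Bool
    start : Vertex
    sdir  : Dir
    sdir∈ : S start sdir ≡ true

-- Strong embroiderability of a configuration C (with n = length C cells)
-- according to a piercing scheme.  Indices are Fin (4n), index 0 being
-- the paper's index 1.
record StronglyEmbroidery (C : Configuration) (𝒮 : Scheme) : Set where
  open Scheme 𝒮
  N : ℕ
  N = 4 ℕ.* length C
  field
    y : Fin N → Vertex
    ε : Fin N → Dir
    first : ∃[ i ] (toℕ i ≡ 0 × y i ≡ start × ε i ≡ sdir)
    alternate : ∀ i → ε (csuc i) ≢ ε i
    frontDiag : ∀ i → ε i ≡ up →
      ∃[ c ] ∃[ k ] (c ∈ C × SameSegment (y i) (y (csuc i)) (diagEnds c k))
    diagOnce : ∀ c k → c ∈ C →
      ∃[ i ] ((ε i ≡ up × SameSegment (y i) (y (csuc i)) (diagEnds c k)) ×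
              (∀ j → ε j ≡ up → SameSegment (y j) (y (csuc j)) (diagEnds c k) → j ≡ i))
    lowerFirst : ∀ c → c ∈ C → ∀ i j →
      ε i ≡ up → SameSegment (y i) (y (csuc i)) (diagEnds c lower) →
      ε j ≡ up → SameSegment (y j) (y (csuc j)) (diagEnds c upper) →
      i < j
    backAdj : ∀ i → ε i ≡ down → Adjacent (y i) (y (csuc i))
    scheme : ∀ v d → (S v d ≡ true) ⇔ (∃[ i ] (y i ≡ v × ε i ≡ d))

StronglyEmbroiderable : Configuration → Scheme → Set
StronglyEmbroiderable C 𝒮 = StronglyEmbroidery C 𝒮

Disjoint : Configuration → Configuration → Set
Disjoint C₁ C₂ = ∀ c → c ∈ C₁ → ¬ (c ∈ C₂)

unionScheme : Scheme → Scheme → Scheme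
unionScheme 𝒮₁ 𝒮₂ = record
  { S     = λ v d → Scheme.S 𝒮₁ v d ∨ Scheme.S 𝒮₂ v d
  ; start = Scheme.start 𝒮₁
  ; sdir  = Scheme.sdir 𝒮₁
  ; sdir∈ = lemma (Scheme.S 𝒮₁ (Scheme.start 𝒮₁) (Scheme.sdir 𝒮₁))
                  (Scheme.S 𝒮₂ (Scheme.start 𝒮₁) (Scheme.sdir 𝒮₁))
                  (Scheme.sdir∈ 𝒮₁)
  }
  where
  lemma : ∀ a b → a ≡ true → (a ∨ b) ≡ true
  lemma true b _ = Relation.Binary.PropositionalEquality.refl

module Submission where

open import Defs
open import Data.List using (_++_)
open import Data.List.Relation.Unary.Unique.Propositional using (Unique)
open import Data.Bool using (true)
open import Relation.Binary.PropositionalEquality using (_≡_)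

open import Data.Bool using (false; _∨_)
open import Data.Empty using (⊥; ⊥-elim)
open import Data.Fin as Fin using (Fin; zero; suc; toℕ; fromℕ<)
open import Data.Fin.Properties
  using (toℕ<n; toℕ-fromℕ<; toℕ-injective; toℕ-inject₁; toℕ-fromℕ)
open import Data.Integer using (_⊓_; 1ℤ)
import Data.Integer.Properties as ℤ
open import Data.List using (length)
open import Data.List.Membership.Propositional using (_∈_)
open import Data.List.Membership.Propositional.Properties using (∈-++⁺ˡ; ∈-++⁺ʳ; ∈-++⁻)
open import Data.List.Properties using (length-++)
open import Data.Nat using (ℕ; suc; _+_; _*_; _∸_; _<_; _≤_; _<?_; _≤?_; z≤n; s≤s; s≤s⁻¹)
open import Data.Nat.Properties
open import Data.Product using (_×_; _,_; proj₁; proj₂; ∃-syntax)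
open import Data.Sum using (_⊎_; inj₁; inj₂)
open import Function.Bundles using (_⇔_; mk⇔; Equivalence)
open import Relation.Binary.Definitions using (tri<; tri≈; tri>)
open import Relation.Binary.PropositionalEquality
open import Relation.Nullary using (yes; no)

-- A strong embroidery is a cyclic sequence of piercings.  Let E₁, E₂ embroider
-- the disjoint configurations C₁, C₂.  Since σ ∈ S₁(s), some piercing j of E₁
-- is the starting piercing (s,σ) of E₂; let p be the cyclic predecessor of j.
-- Inserting the whole cycle E₂ between p and j gives an embroidery of C₁ ∪ C₂:
-- the thread follows E₁ up to p, makes the back stitch of E₁ leaving p, which now
-- ends at (s,σ) where E₂ starts, runs once around E₂, whose last back stitch ends
-- at (s,σ) = (y₁ j, ε₁ j), and continues along E₁.  If j = 0 then p is the last
-- position and E₂ is appended, so the sequence still starts at the start of E₁.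

corner : Vertex → Vertex → Vertex
corner (x₁ , y₁) (x₂ , y₂) = (x₁ ⊓ x₂ , y₁ ⊓ y₂)

corner-comm : ∀ p q → corner p q ≡ corner q p
corner-comm (x₁ , y₁) (x₂ , y₂) = cong₂ _,_ (ℤ.⊓-comm x₁ x₂) (ℤ.⊓-comm y₁ y₂)

corner-diagonal : ∀ c k → corner (proj₁ (diagEnds c k)) (proj₂ (diagEnds c k)) ≡ c
corner-diagonal (a , b) lower = cong₂ _,_ (ℤ.i≤j⇒i⊓j≡i (ℤ.i≤i+j a 1ℤ)) (ℤ.i≤j⇒i⊓j≡i (ℤ.i≤i+j b 1ℤ))
corner-diagonal (a , b) upper = cong₂ _,_ (ℤ.i≤j⇒i⊓j≡i (ℤ.i≤i+j a 1ℤ)) (ℤ.i≥j⇒i⊓j≡j (ℤ.i≤i+j b 1ℤ))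

corner-segment : ∀ {p q} e → SameSegment p q e → corner p q ≡ corner (proj₁ e) (proj₂ e)
corner-segment _ (inj₁ (refl , refl)) = refl
corner-segment _ (inj₂ (refl , refl)) = corner-comm _ _

diagonal-cell : ∀ {p q} c k c′ k′ →
  SameSegment p q (diagEnds c k) → SameSegment p q (diagEnds c′ k′) → c ≡ c′
diagonal-cell {p} {q} c k c′ k′ s s′ = begin
  c                                                        ≡⟨ corner-diagonal c k ⟨
  corner (proj₁ (diagEnds c k)) (proj₂ (diagEnds c k))     ≡⟨ corner-segment _ s ⟨
  corner p q                                               ≡⟨ corner-segment _ s′ ⟩
  corner (proj₁ (diagEnds c′ k′)) (proj₂ (diagEnds c′ k′)) ≡⟨ corner-diagonal c′ k′ ⟩
  c′                                                       ∎
  where open ≡-Reasoning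

csuc-inner : ∀ {m} (i : Fin m) → suc (toℕ i) < m → toℕ (csuc i) ≡ suc (toℕ i)
csuc-inner {suc m} i lt with suc (toℕ i) <? suc m
... | yes lt′ = toℕ-fromℕ< lt′
... | no ¬lt  = ⊥-elim (¬lt lt)

csuc-last : ∀ {m} (i : Fin m) → suc (toℕ i) ≡ m → toℕ (csuc i) ≡ 0
csuc-last {suc m} i eq with suc (toℕ i) <? suc m
... | yes lt = ⊥-elim (<-irrefl eq lt)
... | no _   = refl

data CSucView {m} (i : Fin m) : Set where
  inner : suc (toℕ i) < m → CSucView i
  last  : suc (toℕ i) ≡ m → CSucView i

csuc-view : ∀ {m} (i : Fin m) → CSucView i
csuc-view i with m≤n⇒m<n∨m≡n (toℕ<n i)
... | inj₁ lt = inner lt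
... | inj₂ eq = last eq

csuc-predecessor : ∀ {m} (j : Fin m) → ∃[ p ] csuc p ≡ j
csuc-predecessor {suc m} zero =
  Fin.fromℕ m , toℕ-injective (csuc-last (Fin.fromℕ m) (cong suc (toℕ-fromℕ m)))
csuc-predecessor {suc m} (suc j) =
  Fin.inject₁ j , toℕ-injective (trans (csuc-inner (Fin.inject₁ j) bound) (cong suc (toℕ-inject₁ j)))
  where
  bound : suc (toℕ (Fin.inject₁ j)) < suc m
  bound = subst (λ x → suc x < suc m) (sym (toℕ-inject₁ j)) (toℕ<n (suc j))

strictMono⇒injective : ∀ {m n} (f : Fin m → Fin n) →
  (∀ {a b} → a Fin.< b → f a Fin.< f b) → ∀ {a b} → f a ≡ f b → a ≡ b
strictMono⇒injective f mono {a} {b} eq with Data.Fin.Properties.<-cmp a b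
... | tri< a<b _ _ = ⊥-elim (<-irrefl (cong toℕ eq) (mono a<b))
... | tri≈ _ a≡b _ = a≡b
... | tri> _ _ b<a = ⊥-elim (<-irrefl (cong toℕ (sym eq)) (mono b<a))

next : ∀ {N₁ N₂} → Fin N₁ ⊎ Fin N₂ → Fin N₁ ⊎ Fin N₂
next (inj₁ a) = inj₁ (csuc a)
next (inj₂ b) = inj₂ (csuc b)

_≺_ : ∀ {N₁ N₂} → Fin N₁ ⊎ Fin N₂ → Fin N₁ ⊎ Fin N₂ → Set
inj₁ a ≺ inj₁ a′ = a Fin.< a′
inj₂ b ≺ inj₂ b′ = b Fin.< b′
_      ≺ _       = ⊥

-- Splicing a cycle of length N₂, opened at its position z = 0, into a cycle of
-- length N₁ right after position p.  The spliced cycle has M = N₁ + N₂ positions: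
-- positions 0 … p of cycle 1, then the whole of cycle 2, then the rest of cycle 1.
-- ι sends each original position to its place in the spliced cycle.
module Splice {N₁ N₂ : ℕ} (p : Fin N₁) (z : Fin N₂) (z≡0 : toℕ z ≡ 0)
              (M : ℕ) (N₁+N₂≡M : N₁ + N₂ ≡ M) where

  -- Cycle 2 occupies the positions k … k + N₂ - 1.
  k : ℕ
  k = suc (toℕ p)

  k≤N₁ : k ≤ N₁
  k≤N₁ = toℕ<n p

  0<N₂ : 0 < N₂
  0<N₂ = subst (_< N₂) z≡0 (toℕ<n z)

  <M : ∀ {t} → t < N₁ + N₂ → t < M
  <M {t} = subst (t <_) N₁+N₂≡M

  <N₁+N₂ : ∀ {t} → t < M → t < N₁ + N₂
  <N₁+N₂ {t} = subst (t <_) (sym N₁+N₂≡M)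

  U : Set
  U = Fin N₁ ⊎ Fin N₂

  data Side (a : Fin N₁) : Set where
    before : toℕ a ≤ toℕ p → Side a
    after  : toℕ p < toℕ a → Side a

  side : ∀ a → Side a
  side a with toℕ a ≤? toℕ p
  ... | yes a≤p = before a≤p
  ... | no  a≰p = after (≰⇒> a≰p)

  ι₁ : Fin N₁ → Fin M
  ι₁ a with side a
  ... | before _ = fromℕ< (<M (<-≤-trans (toℕ<n a) (m≤m+n N₁ N₂)))
  ... | after _  = fromℕ< (<M (+-monoˡ-< N₂ (toℕ<n a)))

  ι₁-before : ∀ a → toℕ a ≤ toℕ p → toℕ (ι₁ a) ≡ toℕ a
  ι₁-before a a≤p with side a
  ... | before _  = toℕ-fromℕ< _
  ... | after p<a = ⊥-elim (<⇒≱ p<a a≤p)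

  ι₁-after : ∀ a → toℕ p < toℕ a → toℕ (ι₁ a) ≡ toℕ a + N₂
  ι₁-after a p<a with side a
  ... | before a≤p = ⊥-elim (<⇒≱ p<a a≤p)
  ... | after _    = toℕ-fromℕ< _

  ι₂ : Fin N₂ → Fin M
  ι₂ b = fromℕ< (<M (<-≤-trans (+-monoʳ-< k (toℕ<n b)) (+-monoˡ-≤ N₂ k≤N₁)))

  ι₂-value : ∀ b → toℕ (ι₂ b) ≡ k + toℕ b
  ι₂-value b = toℕ-fromℕ< _

  ι : U → Fin M
  ι (inj₁ a) = ι₁ a
  ι (inj₂ b) = ι₂ b

  ι₁-mono : ∀ {a a′} → a Fin.< a′ → ι₁ a Fin.< ι₁ a′
  ι₁-mono {a} {a′} a<a′ = by-sides (side a) (side a′)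
    where
    by-sides : Side a → Side a′ → ι₁ a Fin.< ι₁ a′
    by-sides (before a≤p) (before a′≤p) =
      subst₂ _<_ (sym (ι₁-before a a≤p)) (sym (ι₁-before a′ a′≤p)) a<a′
    by-sides (before a≤p) (after p<a′) =
      subst₂ _<_ (sym (ι₁-before a a≤p)) (sym (ι₁-after a′ p<a′)) (<-≤-trans a<a′ (m≤m+n _ N₂))
    by-sides (after p<a) (before a′≤p) = ⊥-elim (<⇒≱ (<-trans p<a a<a′) a′≤p)
    by-sides (after p<a) (after p<a′) =
      subst₂ _<_ (sym (ι₁-after a p<a)) (sym (ι₁-after a′ p<a′)) (+-monoˡ-< N₂ a<a′)

  ι₂-mono : ∀ {b b′} → b Fin.< b′ → ι₂ b Fin.< ι₂ b′
  ι₂-mono {b} {b′} b<b′ = subst₂ _<_ (sym (ι₂-value b)) (sym (ι₂-value b′)) (+-monoʳ-< k b<b′)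

  ι₁≢ι₂ : ∀ a b → ι₁ a ≢ ι₂ b
  ι₁≢ι₂ a b eq = by-side (side a)
    where
    open ≤-Reasoning
    by-side : Side a → ⊥
    by-side (before a≤p) = <-irrefl (cong toℕ eq) (begin-strict
      toℕ (ι₁ a)  ≡⟨ ι₁-before a a≤p ⟩
      toℕ a       <⟨ s≤s a≤p ⟩
      k           ≤⟨ m≤m+n k (toℕ b) ⟩
      k + toℕ b   ≡⟨ ι₂-value b ⟨
      toℕ (ι₂ b)  ∎)
    by-side (after p<a) = <-irrefl (cong toℕ (sym eq)) (begin-strict
      toℕ (ι₂ b)     ≡⟨ ι₂-value b ⟩
      k + toℕ b      <⟨ +-monoʳ-< k (toℕ<n b) ⟩
      k + N₂         ≤⟨ +-monoˡ-≤ N₂ p<a ⟩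
      toℕ a + N₂     ≡⟨ ι₁-after a p<a ⟨
      toℕ (ι₁ a)     ∎)

  ι-mono : ∀ {u v} → u ≺ v → ι u Fin.< ι v
  ι-mono {inj₁ a} {inj₁ a′} = ι₁-mono
  ι-mono {inj₂ b} {inj₂ b′} = ι₂-mono
  ι-mono {inj₁ _} {inj₂ _} ()
  ι-mono {inj₂ _} {inj₁ _} ()

  ι₁-first : ∀ a → toℕ a ≡ 0 → toℕ (ι₁ a) ≡ 0
  ι₁-first a a≡0 = trans (ι₁-before a (subst (_≤ toℕ p) (sym a≡0) z≤n)) a≡0

  ι-injective : ∀ {u v} → ι u ≡ ι v → u ≡ v
  ι-injective {inj₁ a} {inj₁ a′} eq = cong inj₁ (strictMono⇒injective ι₁ ι₁-mono eq)
  ι-injective {inj₂ b} {inj₂ b′} eq = cong inj₂ (strictMono⇒injective ι₂ ι₂-mono eq)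
  ι-injective {inj₁ a} {inj₂ b}  eq = ⊥-elim (ι₁≢ι₂ a b eq)
  ι-injective {inj₂ b} {inj₁ a}  eq = ⊥-elim (ι₁≢ι₂ a b (sym eq))

  cover : ∀ t → ∃[ u ] ι u ≡ t
  cover t with toℕ t <? k
  ... | yes t<k = inj₁ a , toℕ-injective (trans (ι₁-before a a≤p) (toℕ-fromℕ< _))
    where
    a : Fin N₁
    a = fromℕ< (<-≤-trans t<k k≤N₁)
    a≤p : toℕ a ≤ toℕ p
    a≤p = subst (_≤ toℕ p) (sym (toℕ-fromℕ< _)) (s≤s⁻¹ t<k)
  ... | no t≮k with toℕ t <? k + N₂
  ...   | yes t<k+N₂ = inj₂ b , toℕ-injective (begin
    toℕ (ι₂ b)          ≡⟨ ι₂-value b ⟩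
    k + toℕ b           ≡⟨ cong (k +_) (toℕ-fromℕ< _) ⟩
    k + (toℕ t ∸ k)     ≡⟨ m+[n∸m]≡n (≮⇒≥ t≮k) ⟩
    toℕ t               ∎)
    where
    open ≡-Reasoning
    b : Fin N₂
    b = fromℕ< (subst (toℕ t ∸ k <_) (m+n∸m≡n k N₂) (∸-monoˡ-< t<k+N₂ (≮⇒≥ t≮k)))
  ...   | no t≮k+N₂ = inj₁ a , toℕ-injective (begin
    toℕ (ι₁ a)          ≡⟨ ι₁-after a p<a ⟩
    toℕ a + N₂          ≡⟨ cong (_+ N₂) (toℕ-fromℕ< _) ⟩
    toℕ t ∸ N₂ + N₂     ≡⟨ m∸n+n≡m (≤-trans (m≤n+m N₂ k) (≮⇒≥ t≮k+N₂)) ⟩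
    toℕ t               ∎)
    where
    open ≡-Reasoning
    a : Fin N₁
    a = fromℕ< (subst (toℕ t ∸ N₂ <_) (m+n∸n≡m N₁ N₂)
          (∸-monoˡ-< (<N₁+N₂ (toℕ<n t)) (≤-trans (m≤n+m N₂ k) (≮⇒≥ t≮k+N₂))))
    p<a : toℕ p < toℕ a
    p<a = subst (k ≤_) (sym (toℕ-fromℕ< _)) (m+n≤o⇒m≤o∸n k (≮⇒≥ t≮k+N₂))

  φ : Fin M → U
  φ t = proj₁ (cover t)

  ι-φ : ∀ t → ι (φ t) ≡ t
  ι-φ t = proj₂ (cover t)

  φ-ι : ∀ u → φ (ι u) ≡ u
  φ-ι u = ι-injective (ι-φ (ι u))

  data Step : U → U → Set where
    along : ∀ u → Step u (next u)
    enter : Step (inj₁ p) (inj₂ z)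
    leave : ∀ b → csuc b ≡ z → Step (inj₂ b) (inj₁ (csuc p))

  k<N₁+N₂ : k < N₁ + N₂
  k<N₁+N₂ = ≤-<-trans k≤N₁ (m<m+n N₁ 0<N₂)

  csuc-inner-at : ∀ {t : Fin M} {n} → toℕ t ≡ n → suc n < N₁ + N₂ → toℕ (csuc t) ≡ suc n
  csuc-inner-at {t} refl n<M = csuc-inner t (<M n<M)

  csuc-last-at : ∀ {t : Fin M} {n} → toℕ t ≡ n → suc n ≡ N₁ + N₂ → toℕ (csuc t) ≡ 0
  csuc-last-at {t} refl n≡M = csuc-last t (trans n≡M N₁+N₂≡M)

  ι₁-step : ∀ a → ∃[ v ] (Step (inj₁ a) v × csuc (ι₁ a) ≡ ι v)
  ι₁-step a = by-side (side a)
    where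
    open ≡-Reasoning
    by-side : Side a → ∃[ v ] (Step (inj₁ a) v × csuc (ι₁ a) ≡ ι v)
    by-side (before a≤p) with m≤n⇒m<n∨m≡n a≤p
    ... | inj₁ a<p = inj₁ (csuc a) , along _ , toℕ-injective (begin
      toℕ (csuc (ι₁ a))   ≡⟨ csuc-inner-at (ι₁-before a a≤p) (<-trans (s≤s a<p) k<N₁+N₂) ⟩
      suc (toℕ a)         ≡⟨ sa≡ ⟨
      toℕ (csuc a)        ≡⟨ ι₁-before (csuc a) (subst (_≤ toℕ p) (sym sa≡) a<p) ⟨
      toℕ (ι₁ (csuc a))   ∎)
      where
      sa≡ : toℕ (csuc a) ≡ suc (toℕ a)
      sa≡ = csuc-inner a (<-≤-trans (s≤s a<p) k≤N₁)
    ... | inj₂ a≡p with toℕ-injective a≡p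
    ...   | refl = inj₂ z , enter , toℕ-injective (begin
      toℕ (csuc (ι₁ p))   ≡⟨ csuc-inner-at (ι₁-before p a≤p) k<N₁+N₂ ⟩
      k                   ≡⟨ +-identityʳ k ⟨
      k + 0               ≡⟨ cong (k +_) z≡0 ⟨
      k + toℕ z           ≡⟨ ι₂-value z ⟨
      toℕ (ι₂ z)          ∎)
    by-side (after p<a) with csuc-view a
    ... | inner sa<N₁ = inj₁ (csuc a) , along _ , toℕ-injective (begin
      toℕ (csuc (ι₁ a))   ≡⟨ csuc-inner-at (ι₁-after a p<a) (+-monoˡ-< N₂ sa<N₁) ⟩
      suc (toℕ a) + N₂    ≡⟨ cong (_+ N₂) sa≡ ⟨
      toℕ (csuc a) + N₂   ≡⟨ ι₁-after (csuc a) (subst (toℕ p <_) (sym sa≡) (m<n⇒m<1+n p<a)) ⟨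
      toℕ (ι₁ (csuc a))   ∎)
      where
      sa≡ : toℕ (csuc a) ≡ suc (toℕ a)
      sa≡ = csuc-inner a sa<N₁
    ... | last sa≡N₁ = inj₁ (csuc a) , along _ , toℕ-injective (begin
      toℕ (csuc (ι₁ a))   ≡⟨ csuc-last-at (ι₁-after a p<a) (cong (_+ N₂) sa≡N₁) ⟩
      0                   ≡⟨ csuc-last a sa≡N₁ ⟨
      toℕ (csuc a)        ≡⟨ ι₁-before (csuc a) (subst (_≤ toℕ p) (sym (csuc-last a sa≡N₁)) z≤n) ⟨
      toℕ (ι₁ (csuc a))   ∎)

  ι₂-step : ∀ b → ∃[ v ] (Step (inj₂ b) v × csuc (ι₂ b) ≡ ι v)
  ι₂-step b with csuc-view b
  ... | inner sb<N₂ = inj₂ (csuc b) , along _ , toℕ-injective (begin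
    toℕ (csuc (ι₂ b))     ≡⟨ csuc-inner-at (ι₂-value b) sk+b<M ⟩
    suc (k + toℕ b)       ≡⟨ +-suc k (toℕ b) ⟨
    k + suc (toℕ b)       ≡⟨ cong (k +_) (csuc-inner b sb<N₂) ⟨
    k + toℕ (csuc b)      ≡⟨ ι₂-value (csuc b) ⟨
    toℕ (ι₂ (csuc b))     ∎)
    where
    open ≡-Reasoning
    sk+b<M : suc (k + toℕ b) < N₁ + N₂
    sk+b<M = subst (_< N₁ + N₂) (+-suc k (toℕ b))
               (<-≤-trans (+-monoʳ-< k sb<N₂) (+-monoˡ-≤ N₂ k≤N₁))
  ... | last sb≡N₂ = inj₁ (csuc p) , leave b sb≡z , toℕ-injective (by-view (csuc-view p))
    where
    open ≡-Reasoning
    sb≡z : csuc b ≡ z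
    sb≡z = toℕ-injective (trans (csuc-last b sb≡N₂) (sym z≡0))
    sk+b≡k+N₂ : suc (k + toℕ b) ≡ k + N₂
    sk+b≡k+N₂ = trans (sym (+-suc k (toℕ b))) (cong (k +_) sb≡N₂)
    by-view : CSucView p → toℕ (csuc (ι₂ b)) ≡ toℕ (ι₁ (csuc p))
    by-view (inner k<N₁) = begin
      toℕ (csuc (ι₂ b))     ≡⟨ csuc-inner-at (ι₂-value b) (subst (_< N₁ + N₂) (sym sk+b≡k+N₂) (+-monoˡ-< N₂ k<N₁)) ⟩
      suc (k + toℕ b)       ≡⟨ sk+b≡k+N₂ ⟩
      k + N₂                ≡⟨ cong (_+ N₂) sp≡k ⟨
      toℕ (csuc p) + N₂     ≡⟨ ι₁-after (csuc p) (subst (toℕ p <_) (sym sp≡k) (n<1+n (toℕ p))) ⟨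
      toℕ (ι₁ (csuc p))     ∎
      where
      sp≡k : toℕ (csuc p) ≡ k
      sp≡k = csuc-inner p k<N₁
    by-view (last k≡N₁) = begin
      toℕ (csuc (ι₂ b))     ≡⟨ csuc-last-at (ι₂-value b) (trans sk+b≡k+N₂ (cong (_+ N₂) k≡N₁)) ⟩
      0                     ≡⟨ csuc-last p k≡N₁ ⟨
      toℕ (csuc p)          ≡⟨ ι₁-before (csuc p) (subst (_≤ toℕ p) (sym (csuc-last p k≡N₁)) z≤n) ⟨
      toℕ (ι₁ (csuc p))     ∎

  ι-step : ∀ u → ∃[ v ] (Step u v × csuc (ι u) ≡ ι v)
  ι-step (inj₁ a) = ι₁-step a
  ι-step (inj₂ b) = ι₂-step b

  step : ∀ t → Step (φ t) (φ (csuc t))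
  step t with ι-step (φ t)
  ... | v , φt→v , csuc-ιφt≡ιv = subst (Step (φ t)) (sym φ-csuc-t≡v) φt→v
    where
    φ-csuc-t≡v : φ (csuc t) ≡ v
    φ-csuc-t≡v = begin
      φ (csuc t)           ≡⟨ cong (λ s → φ (csuc s)) (ι-φ t) ⟨
      φ (csuc (ι (φ t)))   ≡⟨ cong φ csuc-ιφt≡ιv ⟩
      φ (ι v)              ≡⟨ φ-ι v ⟩
      v                    ∎
      where open ≡-Reasoning

∨≡true⇔ : ∀ a b → (a ∨ b ≡ true) ⇔ (a ≡ true ⊎ b ≡ true)
∨≡true⇔ true  b     = mk⇔ (λ _ → inj₁ refl) (λ _ → refl)
∨≡true⇔ false true  = mk⇔ inj₂ (λ _ → refl)
∨≡true⇔ false false = mk⇔ inj₁ λ { (inj₁ ()) ; (inj₂ ()) }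

module DisjointUnion {C₁ C₂ : Configuration} {𝒮₁ 𝒮₂ : Scheme} (C₁∩C₂≡∅ : Disjoint C₁ C₂)
                     (E₁ : StronglyEmbroidery C₁ 𝒮₁) (E₂ : StronglyEmbroidery C₂ 𝒮₂) where

  module E₁ = StronglyEmbroidery E₁
  module E₂ = StronglyEmbroidery E₂

  U : Set
  U = Fin (4 * length C₁) ⊎ Fin (4 * length C₂)

  vertex : U → Vertex
  vertex (inj₁ a) = E₁.y a
  vertex (inj₂ b) = E₂.y b

  dir : U → Dir
  dir (inj₁ a) = E₁.ε a
  dir (inj₂ b) = E₂.ε b

  FrontStitch : U → Vertex × Vertex → Set
  FrontStitch u e = dir u ≡ up × SameSegment (vertex u) (vertex (next u)) e

  alternate : ∀ u → dir (next u) ≢ dir u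
  alternate (inj₁ a) = E₁.alternate a
  alternate (inj₂ b) = E₂.alternate b

  backAdj : ∀ u → dir u ≡ down → Adjacent (vertex u) (vertex (next u))
  backAdj (inj₁ a) = E₁.backAdj a
  backAdj (inj₂ b) = E₂.backAdj b

  frontDiag : ∀ u → dir u ≡ up →
    ∃[ c ] ∃[ k ] (c ∈ C₁ ++ C₂ × SameSegment (vertex u) (vertex (next u)) (diagEnds c k))
  frontDiag (inj₁ a) is-up with E₁.frontDiag a is-up
  ... | c , k , c∈C₁ , seg = c , k , ∈-++⁺ˡ c∈C₁ , seg
  frontDiag (inj₂ b) is-up with E₂.frontDiag b is-up
  ... | c , k , c∈C₂ , seg = c , k , ∈-++⁺ʳ C₁ c∈C₂ , seg

  stitched-in-E₁ : ∀ {u} c k → c ∈ C₁ → FrontStitch u (diagEnds c k) → ∃[ a ] u ≡ inj₁ a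
  stitched-in-E₁ {inj₁ a} _ _ _ _ = a , refl
  stitched-in-E₁ {inj₂ b} c k c∈C₁ (is-up , seg) with E₂.frontDiag b is-up
  ... | c′ , k′ , c′∈C₂ , seg′ =
    ⊥-elim (C₁∩C₂≡∅ _ c∈C₁ (subst (_∈ C₂) (sym (diagonal-cell c k c′ k′ seg seg′)) c′∈C₂))

  stitched-in-E₂ : ∀ {u} c k → c ∈ C₂ → FrontStitch u (diagEnds c k) → ∃[ b ] u ≡ inj₂ b
  stitched-in-E₂ {inj₂ b} _ _ _ _ = b , refl
  stitched-in-E₂ {inj₁ a} c k c∈C₂ (is-up , seg) with E₁.frontDiag a is-up
  ... | c′ , k′ , c′∈C₁ , seg′ =
    ⊥-elim (C₁∩C₂≡∅ _ c′∈C₁ (subst (_∈ C₂) (diagonal-cell c k c′ k′ seg seg′) c∈C₂))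

  diagOnce : ∀ c k → c ∈ C₁ ++ C₂ →
    ∃[ u ] (FrontStitch u (diagEnds c k) × (∀ v → FrontStitch v (diagEnds c k) → v ≡ u))
  diagOnce c k c∈C with ∈-++⁻ C₁ c∈C
  ... | inj₁ c∈C₁ with E₁.diagOnce c k c∈C₁
  ...   | a , stitch , unique = inj₁ a , stitch , only-a
    where
    only-a : ∀ v → FrontStitch v (diagEnds c k) → v ≡ inj₁ a
    only-a v stitch′ with stitched-in-E₁ {v} c k c∈C₁ stitch′
    ... | a′ , refl = cong inj₁ (unique a′ (proj₁ stitch′) (proj₂ stitch′))
  diagOnce c k c∈C | inj₂ c∈C₂ with E₂.diagOnce c k c∈C₂
  ...   | b , stitch , unique = inj₂ b , stitch , only-b
    where
    only-b : ∀ v → FrontStitch v (diagEnds c k) → v ≡ inj₂ b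
    only-b v stitch′ with stitched-in-E₂ {v} c k c∈C₂ stitch′
    ... | b′ , refl = cong inj₂ (unique b′ (proj₁ stitch′) (proj₂ stitch′))

  lowerFirst : ∀ c {u v} → c ∈ C₁ ++ C₂ →
    FrontStitch u (diagEnds c lower) → FrontStitch v (diagEnds c upper) → u ≺ v
  lowerFirst c {u} {v} c∈C lo hi with ∈-++⁻ C₁ c∈C
  ... | inj₁ c∈C₁ with stitched-in-E₁ {u} c lower c∈C₁ lo | stitched-in-E₁ {v} c upper c∈C₁ hi
  ...   | a , refl | a′ , refl = E₁.lowerFirst c c∈C₁ a a′ (proj₁ lo) (proj₂ lo) (proj₁ hi) (proj₂ hi)
  lowerFirst c {u} {v} c∈C lo hi | inj₂ c∈C₂ with stitched-in-E₂ {u} c lower c∈C₂ lo | stitched-in-E₂ {v} c upper c∈C₂ hi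
  ...   | b , refl | b′ , refl = E₂.lowerFirst c c∈C₂ b b′ (proj₁ lo) (proj₂ lo) (proj₁ hi) (proj₂ hi)

  scheme : ∀ v d → ((Scheme.S 𝒮₁ v d ∨ Scheme.S 𝒮₂ v d) ≡ true) ⇔ (∃[ u ] (vertex u ≡ v × dir u ≡ d))
  scheme v d = mk⇔ to from
    where
    to : (Scheme.S 𝒮₁ v d ∨ Scheme.S 𝒮₂ v d) ≡ true → ∃[ u ] (vertex u ≡ v × dir u ≡ d)
    to S∋ with Equivalence.to (∨≡true⇔ _ _) S∋
    ... | inj₁ S₁∋ = let a , pierced = Equivalence.to (E₁.scheme v d) S₁∋ in inj₁ a , pierced
    ... | inj₂ S₂∋ = let b , pierced = Equivalence.to (E₂.scheme v d) S₂∋ in inj₂ b , pierced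
    from : ∃[ u ] (vertex u ≡ v × dir u ≡ d) → (Scheme.S 𝒮₁ v d ∨ Scheme.S 𝒮₂ v d) ≡ true
    from (inj₁ a , pierced) = Equivalence.from (∨≡true⇔ _ _) (inj₁ (Equivalence.from (E₁.scheme v d) (a , pierced)))
    from (inj₂ b , pierced) = Equivalence.from (∨≡true⇔ _ _) (inj₂ (Equivalence.from (E₂.scheme v d) (b , pierced)))

module Spliced {C₁ C₂ : Configuration} {𝒮₁ 𝒮₂ : Scheme} (C₁∩C₂≡∅ : Disjoint C₁ C₂)
               (E₁ : StronglyEmbroidery C₁ 𝒮₁) (E₂ : StronglyEmbroidery C₂ 𝒮₂)
               (p : Fin (4 * length C₁)) (z : Fin (4 * length C₂)) (z≡0 : toℕ z ≡ 0)
               (same-vertex : StronglyEmbroidery.y E₁ (csuc p) ≡ StronglyEmbroidery.y E₂ z)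
               (same-dir : StronglyEmbroidery.ε E₁ (csuc p) ≡ StronglyEmbroidery.ε E₂ z) where

  module ⊎E = DisjointUnion C₁∩C₂≡∅ E₁ E₂
  open ⊎E using (vertex; dir; FrontStitch)

  length-splice : 4 * length C₁ + 4 * length C₂ ≡ 4 * length (C₁ ++ C₂)
  length-splice = begin
    4 * length C₁ + 4 * length C₂   ≡⟨ *-distribˡ-+ 4 (length C₁) (length C₂) ⟨
    4 * (length C₁ + length C₂)     ≡⟨ cong (4 *_) (length-++ C₁) ⟨
    4 * length (C₁ ++ C₂)           ∎
    where open ≡-Reasoning

  open Splice p z z≡0 (4 * length (C₁ ++ C₂)) length-splice

  y : Fin (4 * length (C₁ ++ C₂)) → Vertex
  y t = vertex (φ t)

  ε : Fin (4 * length (C₁ ++ C₂)) → Dir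
  ε t = dir (φ t)

  step-piercing : ∀ {u v} → Step u v → vertex v ≡ vertex (next u) × dir v ≡ dir (next u)
  step-piercing (along u)     = refl , refl
  step-piercing enter         = sym same-vertex , sym same-dir
  step-piercing (leave b b→z) =
    trans same-vertex (cong (StronglyEmbroidery.y E₂) (sym b→z)) ,
    trans same-dir (cong (StronglyEmbroidery.ε E₂) (sym b→z))

  y-csuc : ∀ t → y (csuc t) ≡ vertex (next (φ t))
  y-csuc t = proj₁ (step-piercing {φ t} {φ (csuc t)} (step t))

  ε-csuc : ∀ t → ε (csuc t) ≡ dir (next (φ t))
  ε-csuc t = proj₂ (step-piercing {φ t} {φ (csuc t)} (step t))

  front-stitch : ∀ t e → ε t ≡ up → SameSegment (y t) (y (csuc t)) e → FrontStitch (φ t) e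
  front-stitch t e is-up seg = is-up , subst (λ w → SameSegment (y t) w e) (y-csuc t) seg

  stitch-front : ∀ u e → FrontStitch u e → ε (ι u) ≡ up × SameSegment (y (ι u)) (y (csuc (ι u))) e
  stitch-front u e (is-up , seg) =
    subst (λ w → dir w ≡ up) (sym (φ-ι u)) is-up ,
    subst (λ w → SameSegment (y (ι u)) w e) (sym (y-csuc (ι u)))
      (subst (λ w → SameSegment (vertex w) (vertex (next w)) e) (sym (φ-ι u)) seg)

  embroidery : StronglyEmbroidery (C₁ ++ C₂) (unionScheme 𝒮₁ 𝒮₂)
  embroidery = record
    { y = y ; ε = ε ; first = first ; alternate = alternate ; frontDiag = frontDiag
    ; diagOnce = diagOnce ; lowerFirst = lowerFirst ; backAdj = backAdj ; scheme = scheme }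
    where
    first : ∃[ i ] (toℕ i ≡ 0 × y i ≡ Scheme.start 𝒮₁ × ε i ≡ Scheme.sdir 𝒮₁)
    first =
      let i , i≡0 , y≡s , ε≡σ = StronglyEmbroidery.first E₁ in
      ι₁ i , ι₁-first i i≡0 , trans (cong vertex (φ-ι (inj₁ i))) y≡s , trans (cong dir (φ-ι (inj₁ i))) ε≡σ

    alternate : ∀ t → ε (csuc t) ≢ ε t
    alternate t eq = ⊎E.alternate (φ t) (trans (sym (ε-csuc t)) eq)

    frontDiag : ∀ t → ε t ≡ up →
      ∃[ c ] ∃[ k ] (c ∈ C₁ ++ C₂ × SameSegment (y t) (y (csuc t)) (diagEnds c k))
    frontDiag t is-up =
      let c , k , c∈C , seg = ⊎E.frontDiag (φ t) is-up in
      c , k , c∈C , subst (λ w → SameSegment (y t) w (diagEnds c k)) (sym (y-csuc t)) seg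

    diagOnce : ∀ c k → c ∈ C₁ ++ C₂ →
      ∃[ i ] ((ε i ≡ up × SameSegment (y i) (y (csuc i)) (diagEnds c k)) ×
              (∀ j → ε j ≡ up → SameSegment (y j) (y (csuc j)) (diagEnds c k) → j ≡ i))
    diagOnce c k c∈C =
      let u , stitch , unique = ⊎E.diagOnce c k c∈C in
      ι u , stitch-front u _ stitch ,
      λ j is-up seg → trans (sym (ι-φ j)) (cong ι (unique (φ j) (front-stitch j _ is-up seg)))

    lowerFirst : ∀ c → c ∈ C₁ ++ C₂ → ∀ i j →
      ε i ≡ up → SameSegment (y i) (y (csuc i)) (diagEnds c lower) →
      ε j ≡ up → SameSegment (y j) (y (csuc j)) (diagEnds c upper) →
      i Fin.< j
    lowerFirst c c∈C i j εi si εj sj =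
      subst₂ Fin._<_ (ι-φ i) (ι-φ j)
        (ι-mono (⊎E.lowerFirst c {φ i} {φ j} c∈C (front-stitch i _ εi si) (front-stitch j _ εj sj)))

    backAdj : ∀ t → ε t ≡ down → Adjacent (y t) (y (csuc t))
    backAdj t is-down = subst (Adjacent (y t)) (sym (y-csuc t)) (⊎E.backAdj (φ t) is-down)

    scheme : ∀ v d → ((Scheme.S 𝒮₁ v d ∨ Scheme.S 𝒮₂ v d) ≡ true) ⇔ (∃[ i ] (y i ≡ v × ε i ≡ d))
    scheme v d = mk⇔
      (λ S∋ → let u , pierced = Equivalence.to (⊎E.scheme v d) S∋ in
              ι u , subst (λ w → vertex w ≡ v × dir w ≡ d) (sym (φ-ι u)) pierced)
      (λ { (t , pierced) → Equivalence.from (⊎E.scheme v d) (φ t , pierced) })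

mainTheorem2 : (C₁ C₂ : Configuration) (𝒮₁ 𝒮₂ : Scheme) →
    Unique C₁ → Unique C₂ → Disjoint C₁ C₂ →
    StronglyEmbroiderable C₁ 𝒮₁ → StronglyEmbroiderable C₂ 𝒮₂ →
    Scheme.S 𝒮₁ (Scheme.start 𝒮₂) (Scheme.sdir 𝒮₂) ≡ true →
    StronglyEmbroiderable (C₁ ++ C₂) (unionScheme 𝒮₁ 𝒮₂)
mainTheorem2 C₁ C₂ 𝒮₁ 𝒮₂ _ _ C₁∩C₂≡∅ E₁ E₂ σ∈S₁[s]
  with StronglyEmbroidery.first E₂ | Equivalence.to (StronglyEmbroidery.scheme E₁ _ _) σ∈S₁[s]
... | z , z≡0 , y₂z≡s , ε₂z≡σ | j , y₁j≡s , ε₁j≡σ with csuc-predecessor j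
...   | p , refl =
  Spliced.embroidery C₁∩C₂≡∅ E₁ E₂ p z z≡0 (trans y₁j≡s (sym y₂z≡s)) (trans ε₁j≡σ (sym ε₂z≡σ))
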